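{- Let $n\ge 3$ be an integer, $\mathbb{F}$ a field, and $f$ a well-covered weighting of the Sierpinski gasket graph $S_n$. Let $P$ be a side of $S_n$. Then $f(v)=0$ for every vertex $v$ of $P$ that does not belong to a simplicial clique of $S_n$, while at each end of $P$ the two vertices of $P$ lying in the simplicial clique at that end have the same weight under $f$.
   Context: The Sierpinski gasket graphs are defined recursively: $S_1=K_3$, whose three vertices are its extreme vertices; $S_{n+1}$ is obtained from three copies of $S_n$ by identifying, for each pair of copies, one extreme vertex of one copy with one extreme vertex of the other (triangular Sierpinski arrangement); the three extreme vertices not identified are the extreme vertices of $S_{n+1}$. For $n\ge2$ the simplicial cliques of $S_n$ are the three triangles $N[x]$, $x$ an extreme vertex. A side of $S_n$ joining two extreme vertices $p,q$ is the path defined recursively: in $S_1$ it is the edge $pq$; in $S_{n+1}$ it is the union of the sides of the two copies of $S_n$ containing $p$ and $q$ respectively, joining $p$ to the shared vertex of these copies and that vertex to $q$ (the boundary path of the gasket; it has $2^{n-1}+1$ vertices). A maximal independent set (MIS) is an independent set not properly contained in another; a weighting $f:V(G)\to\mathbb{F}$ is well-covered if $\sum_{v\in\mathcal{M}}f(v)$ is the same for every MIS $\mathcal{M}$. -}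

module Defs where

open import Level using (Level; _⊔_) renaming (suc to lsuc)
open import Data.Nat using (ℕ; zero; suc)
open import Data.Fin using (Fin; zero; suc)
open import Data.Fin.Properties using (_≟_)
open import Data.Bool using (Bool; true; false; if_then_else_)
open import Data.Empty using (⊥)
open import Data.Sum using (_⊎_; inj₁; inj₂)
open import Data.Product using (Σ; ∃; ∃-syntax; _×_; _,_)
open import Data.List using (List; []; _∷_; map; _++_; foldr; drop)
open import Data.List.Membership.Propositional using (_∈_)
open import Relation.Nullary using (¬_; yes; no)
open import Relation.Binary.PropositionalEquality using (_≡_; _≢_)
open import Algebra.Bundles using (CommutativeRing)

record Field (c ℓ : Level) : Set (lsuc (c ⊔ ℓ)) where
  field
    commutativeRing : CommutativeRing c ℓ
  open CommutativeRing commutativeRing public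
  field
    1≉0     : ¬ (1# ≈ 0#)
    inverse : ∀ x → ¬ (x ≈ 0#) → ∃[ y ] (x * y ≈ 1#)

-- Indexing: `Vert n` is the vertex set of S_n as in the paper
-- (S_1 = K_3).  Index 0 is a junk copy of K_3 and is never used.
-- Vertices of S_n are  inj₁ i  (the extreme vertex number i, i : Fin 3)
-- or  inj₂ v  with v a non-extreme vertex.
-- Non-extreme vertices of S_{n+1} (n ≥ 1) are either one of the three
-- shared vertices  inj₁ k  (the vertex shared by the two copies i, j
-- with {i,j,k} = {0,1,2}), or  inj₂ (i , v)  : the non-extreme vertex v
-- of copy i of S_n.  This is exactly the disjoint union of the three
-- copies with the identifications of the recursive definition.

NE : ℕ → Set
NE zero          = ⊥
NE (suc zero)    = ⊥
NE (suc (suc n)) = Fin 3 ⊎ (Fin 3 × NE (suc n))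

Vert : ℕ → Set
Vert n = Fin 3 ⊎ NE n

-- the third element of {0,1,2} (meaningful when i ≢ j)
third : Fin 3 → Fin 3 → Fin 3
third zero       (suc zero)       = suc (suc zero)
third (suc zero) zero             = suc (suc zero)
third zero       (suc (suc zero)) = suc zero
third (suc (suc zero)) zero       = suc zero
third _ _ = zero

-- embedding of S_n as copy i inside S_{n+1} (n ≥ 1):
-- extreme vertex j of copy i is the extreme vertex i of S_{n+1} if j = i,
-- and otherwise the vertex shared by copies i and j.
emb : (n : ℕ) → Fin 3 → Vert (suc n) → Vert (suc (suc n))
emb n i (inj₁ j) with i ≟ j
... | yes _ = inj₁ i
... | no  _ = inj₂ (inj₁ (third i j))
emb n i (inj₂ v) = inj₂ (inj₂ (i , v))

Adj : (n : ℕ) → Vert n → Vert n → Set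
Adj zero          (inj₁ a) (inj₁ b) = a ≢ b
Adj (suc zero)    (inj₁ a) (inj₁ b) = a ≢ b
Adj (suc (suc n)) x y =
  ∃[ i ] ∃[ a ] ∃[ b ] (Adj (suc n) a b × emb n i a ≡ x × emb n i b ≡ y)

allFin3 : List (Fin 3)
allFin3 = zero ∷ suc zero ∷ suc (suc zero) ∷ []

allNE : (n : ℕ) → List (NE n)
allNE zero          = []
allNE (suc zero)    = []
allNE (suc (suc n)) =
  map inj₁ allFin3 ++
  foldr (λ i acc → map (λ v → inj₂ (i , v)) (allNE (suc n)) ++ acc) [] allFin3

allVert : (n : ℕ) → List (Vert n)
allVert n = map inj₁ allFin3 ++ map inj₂ (allNE n)

-- Sides.  side n p q is the list of vertices of the side joining the
-- extreme vertices p and q (in order from p to q).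

side : (n : ℕ) → Fin 3 → Fin 3 → List (Vert n)
side zero          p q = inj₁ p ∷ inj₁ q ∷ []
side (suc zero)    p q = inj₁ p ∷ inj₁ q ∷ []
side (suc (suc n)) p q =
  map (emb n p) (side (suc n) p q) ++ drop 1 (map (emb n q) (side (suc n) p q))

VSet : ℕ → Set
VSet n = Vert n → Bool

_⊆_ : {n : ℕ} → VSet n → VSet n → Set
S ⊆ T = ∀ v → S v ≡ true → T v ≡ true

Independent : (n : ℕ) → VSet n → Set
Independent n S = ∀ u v → S u ≡ true → S v ≡ true → ¬ Adj n u v

MIS : (n : ℕ) → VSet n → Set
MIS n S = Independent n S × (∀ T → Independent n T → S ⊆ T → T ⊆ S)

InClosedNbhd : (n : ℕ) → Vert n → Vert n → Set
InClosedNbhd n x u = (u ≡ x) ⊎ Adj n x u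

Simplicial : (n : ℕ) → Vert n → Set
Simplicial n x = ∀ a b → Adj n x a → Adj n x b → a ≢ b → Adj n a b

InSimplicialClique : (n : ℕ) → Vert n → Set
InSimplicialClique n v = ∃[ x ] (Simplicial n x × InClosedNbhd n x v)

module _ {c ℓ} (F : Field c ℓ) where
  open Field F

  weight : (n : ℕ) → (Vert n → Carrier) → VSet n → Carrier
  weight n f S = foldr (λ v acc → (if S v then f v else 0#) + acc) 0# (allVert n)

  WellCovered : (n : ℕ) → (Vert n → Carrier) → Set _
  WellCovered n f = ∀ S T → MIS n S → MIS n T → weight n f S ≈ weight n f T

module Submission where

-- The one analytic tool is an exchange lemma: if f is well-covered and
-- A, B are independent sets with the same closed neighbourhood, then
-- f(A) = f(B), because one set M extends both A and B to maximal
-- independent sets.  Closed neighbourhoods in S_n are local, so the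
-- hypotheses of the lemma can be certified by evaluation inside a small
-- window: a copy of S_3, or two copies of S_3 sharing a vertex, embedded
-- in S_n, where only the extreme vertices of the copies may have outside
-- neighbours.  A handful of certified exchanges give three local facts:
-- the middle vertex of a side of a copy of S_3 weighs zero; an extreme
-- vertex of a corner copy of S_3 weighs as much as its side neighbour; in
-- a copy of S_{4+m}, the vertex shared by two of its copies and the next
-- vertex on the side weigh zero.  Induction along the recursive definition
-- of sides then classifies every side vertex as one of the two vertices of
-- a simplicial clique N[p], N[q] at an end, or as an interior vertex of
-- weight zero adjacent to neither end; the theorem follows.

open import Defs
open import Data.Nat using (ℕ; zero; suc; _≤_; z≤n; s≤s) renaming (_+_ to _+ℕ_)
open import Data.Fin using (Fin; zero; suc)
open import Data.Fin.Properties using (_≟_)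
open import Data.Bool using (Bool; true; false; _∨_; _∧_; not; if_then_else_)
open import Data.Bool.Properties using (∨-zeroʳ)
open import Data.Empty using (⊥-elim)
open import Data.Sum using (_⊎_; inj₁; inj₂)
import Data.Sum.Properties as Sum
open import Data.Sum.Properties using (inj₁-injective; inj₂-injective)
open import Data.Product using (∃-syntax; _×_; _,_; proj₁; proj₂)
import Data.Product.Properties as Product
open import Data.Maybe using (Maybe; just; nothing)
open import Data.Maybe.Properties using (just-injective)
open import Data.List using (List; []; _∷_; map; _++_; foldr; drop)
open import Data.Bool.ListAction using (all; any)
open import Data.List.Properties using (map-++)
open import Data.List.Relation.Unary.Any using (Any; here; there; any?)
import Data.List.Relation.Unary.Any.Properties as AnyP
open import Data.List.Relation.Unary.All using ([]; _∷_)
import Data.List.Relation.Unary.All as All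
import Data.List.Relation.Unary.All.Properties as AllP
open import Data.List.Relation.Unary.AllPairs using ([]; _∷_)
open import Data.List.Membership.Propositional using (_∈_; _∉_; find; lose)
open import Data.List.Membership.Propositional.Properties using (∈-map⁺; ∈-map⁻; ∈-++⁺ˡ; ∈-++⁺ʳ; ∈-++⁻)
open import Data.List.Relation.Unary.Unique.Propositional using (Unique)
import Data.List.Relation.Unary.Unique.Propositional.Properties as Unique
open import Data.List.Relation.Binary.Disjoint.Propositional using (Disjoint)
open import Relation.Nullary using (¬_; yes; no; Dec)
open import Relation.Nullary.Decidable using (⌊_⌋; _⊎-dec_)
open import Relation.Binary.Definitions using (DecidableEquality)
open import Relation.Binary.PropositionalEquality using (_≡_; _≢_; refl; sym; trans; cong; subst; subst₂; ≢-sym)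

pattern c0 = zero
pattern c1 = suc zero
pattern c2 = suc (suc zero)

forDistinct : ∀ {ℓ} (P : Fin 3 → Fin 3 → Set ℓ) →
  P c0 c1 → P c0 c2 → P c1 c0 → P c1 c2 → P c2 c0 → P c2 c1 → ∀ i j → i ≢ j → P i j
forDistinct P p01 p02 p10 p12 p20 p21 = λ where
  c0 c0 h → ⊥-elim (h refl)
  c0 c1 _ → p01
  c0 c2 _ → p02
  c1 c0 _ → p10
  c1 c1 h → ⊥-elim (h refl)
  c1 c2 _ → p12
  c2 c0 _ → p20
  c2 c1 _ → p21
  c2 c2 h → ⊥-elim (h refl)

third-sym : ∀ i j → i ≢ j → third i j ≡ third j i
third-sym = forDistinct (λ i j → third i j ≡ third j i) refl refl refl refl refl refl

third-≢ : ∀ i j → i ≢ j → third i j ≢ i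
third-≢ = forDistinct (λ i j → third i j ≢ i) (λ ()) (λ ()) (λ ()) (λ ()) (λ ()) (λ ())

third-inv : ∀ i j → i ≢ j → third i (third i j) ≡ j
third-inv = forDistinct (λ i j → third i (third i j) ≡ j) refl refl refl refl refl refl

third-unique : ∀ x i t → x ≢ i → x ≢ t → i ≢ t → x ≡ third i t
third-unique c0 c0 t h1 h2 h3 = ⊥-elim (h1 refl)
third-unique c1 c1 t h1 h2 h3 = ⊥-elim (h1 refl)
third-unique c2 c2 t h1 h2 h3 = ⊥-elim (h1 refl)
third-unique c0 i c0 h1 h2 h3 = ⊥-elim (h2 refl)
third-unique c1 i c1 h1 h2 h3 = ⊥-elim (h2 refl)
third-unique c2 i c2 h1 h2 h3 = ⊥-elim (h2 refl)
third-unique x c0 c0 h1 h2 h3 = ⊥-elim (h3 refl)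
third-unique x c1 c1 h1 h2 h3 = ⊥-elim (h3 refl)
third-unique x c2 c2 h1 h2 h3 = ⊥-elim (h3 refl)
third-unique c0 c1 c2 h1 h2 h3 = refl
third-unique c0 c2 c1 h1 h2 h3 = refl
third-unique c1 c0 c2 h1 h2 h3 = refl
third-unique c1 c2 c0 h1 h2 h3 = refl
third-unique c2 c0 c1 h1 h2 h3 = refl
third-unique c2 c1 c0 h1 h2 h3 = refl

emb-same : ∀ n i → emb n i (inj₁ i) ≡ inj₁ i
emb-same n i with i ≟ i
... | yes _ = refl
... | no h = ⊥-elim (h refl)

emb-diff : ∀ n i j → i ≢ j → emb n i (inj₁ j) ≡ inj₂ (inj₁ (third i j))
emb-diff n i j h with i ≟ j
... | yes e = ⊥-elim (h e)
... | no _ = refl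

emb-junction : ∀ n i j → i ≢ j → emb n i (inj₁ j) ≡ emb n j (inj₁ i)
emb-junction n i j h =
  trans (emb-diff n i j h)
    (trans (cong (λ t → inj₂ (inj₁ t)) (third-sym i j h)) (sym (emb-diff n j i (≢-sym h))))

restrict : (n : ℕ) → Fin 3 → Vert (suc (suc n)) → Maybe (Vert (suc n))
restrict n i (inj₁ j) with i ≟ j
... | yes _ = just (inj₁ i)
... | no _ = nothing
restrict n i (inj₂ (inj₁ k)) with i ≟ k
... | yes _ = nothing
... | no _ = just (inj₁ (third i k))
restrict n i (inj₂ (inj₂ (j , v))) with i ≟ j
... | yes _ = just (inj₂ v)
... | no _ = nothing

restrict-emb : ∀ n i a → restrict n i (emb n i a) ≡ just a
restrict-emb n i (inj₁ j) with i ≟ j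
restrict-emb n i (inj₁ .i) | yes refl with i ≟ i
... | yes _ = refl
... | no h = ⊥-elim (h refl)
restrict-emb n i (inj₁ j) | no h with i ≟ third i j
... | yes e = ⊥-elim (third-≢ i j h (sym e))
... | no _ = cong (λ k → just (inj₁ k)) (third-inv i j h)
restrict-emb n i (inj₂ v) with i ≟ i
... | yes _ = refl
... | no h = ⊥-elim (h refl)

emb-restrict : ∀ n i x a → restrict n i x ≡ just a → emb n i a ≡ x
emb-restrict n i (inj₁ j) a e with i ≟ j
emb-restrict n i (inj₁ .i) .(inj₁ i) refl | yes refl = emb-same n i
emb-restrict n i (inj₁ j) a () | no _
emb-restrict n i (inj₂ (inj₁ k)) a e with i ≟ k
emb-restrict n i (inj₂ (inj₁ k)) a () | yes _
emb-restrict n i (inj₂ (inj₁ k)) .(inj₁ (third i k)) refl | no h =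
  trans (emb-diff n i (third i k) (λ e → third-≢ i k h (sym e)))
        (cong (λ t → inj₂ (inj₁ t)) (third-inv i k h))
emb-restrict n i (inj₂ (inj₂ (j , v))) a e with i ≟ j
emb-restrict n i (inj₂ (inj₂ (.i , v))) .(inj₂ v) refl | yes refl = refl
emb-restrict n i (inj₂ (inj₂ (j , v))) a () | no _

emb-injective : ∀ n i a b → emb n i a ≡ emb n i b → a ≡ b
emb-injective n i a b e =
  just-injective (trans (sym (restrict-emb n i a)) (trans (cong (restrict n i) e) (restrict-emb n i b)))

emb-to-extreme : ∀ n l a i → emb n l a ≡ inj₁ i → l ≡ i × a ≡ inj₁ i
emb-to-extreme n l (inj₁ m) i e with l ≟ m
emb-to-extreme n l (inj₁ .l) .l refl | yes refl = refl , refl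
emb-to-extreme n l (inj₁ m) i () | no _
emb-to-extreme n l (inj₂ v) i ()

copies-meet : ∀ n i j a a' → i ≢ j → emb n j a' ≡ emb n i a → a ≡ inj₁ j × a' ≡ inj₁ i
copies-meet n i j (inj₂ v) (inj₁ l) h e with j ≟ l
copies-meet n i j (inj₂ v) (inj₁ l) h () | yes _
copies-meet n i j (inj₂ v) (inj₁ l) h () | no _
copies-meet n i j (inj₂ v) (inj₂ w) h refl = ⊥-elim (h refl)
copies-meet n i j (inj₁ k) a' h e with i ≟ k
copies-meet n i j (inj₁ .i) a' h e | yes refl = ⊥-elim (h (sym (proj₁ (emb-to-extreme n j a' i e))))
copies-meet n i j (inj₁ k) (inj₂ w) h () | no _
copies-meet n i j (inj₁ k) (inj₁ l) h e | no hk with j ≟ l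
copies-meet n i j (inj₁ k) (inj₁ .j) h () | no hk | yes refl
... | no hl = cong inj₁ k≡j , cong inj₁ l≡i
  where
  shared : third j l ≡ third i k
  shared = inj₁-injective (inj₂-injective e)
  k≡j : k ≡ j
  k≡j = trans (sym (third-inv i k hk))
    (sym (third-unique j i (third i k) (≢-sym h)
      (λ e' → third-≢ j l hl (trans shared (sym e'))) (λ e' → third-≢ i k hk (sym e'))))
  l≡i : l ≡ i
  l≡i = trans (sym (third-inv j l hl))
    (sym (third-unique i j (third j l) h
      (λ e' → third-≢ i k hk (trans (sym shared) (sym e'))) (λ e' → third-≢ j l hl (sym e'))))

∨-true : ∀ a b → a ∨ b ≡ true → a ≡ true ⊎ b ≡ true
∨-true true b e = inj₁ refl
∨-true false b e = inj₂ e

∧-true : ∀ a b → a ∧ b ≡ true → a ≡ true × b ≡ true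
∧-true true true e = refl , refl

not-true : ∀ {x} → not x ≡ true → x ≡ false
not-true {false} _ = refl

true≢false : true ≢ false
true≢false ()

all-sound : ∀ {X : Set} (p : X → Bool) xs x → all p xs ≡ true → x ∈ xs → p x ≡ true
all-sound p (y ∷ xs) x e (here refl) = proj₁ (∧-true _ _ e)
all-sound p (y ∷ xs) x e (there i) = all-sound p xs x (proj₂ (∧-true _ _ e)) i

any-sound : ∀ {X : Set} (p : X → Bool) xs → any p xs ≡ true → ∃[ x ] (x ∈ xs × p x ≡ true)
any-sound p (y ∷ xs) e with ∨-true _ _ e
... | inj₁ e1 = y , here refl , e1
... | inj₂ e2 with any-sound p xs e2
...   | x , i , h = x , there i , h

any-complete : ∀ {X : Set} (p : X → Bool) xs x → x ∈ xs → p x ≡ true → any p xs ≡ true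
any-complete p (y ∷ xs) x (here refl) h rewrite h = refl
any-complete p (y ∷ xs) x (there i) h rewrite any-complete p xs x i h = ∨-zeroʳ (p y)

implies : ∀ {a b} → not a ∨ b ≡ true → a ≡ true → b ≡ true
implies e refl = e

any-false : ∀ {X : Set} (p : X → Bool) xs x → any p xs ≡ false → x ∈ xs → p x ≡ false
any-false p xs x e i with p x in px
... | true = ⊥-elim (true≢false (trans (sym (any-complete p xs x i px)) e))
... | false = refl

mutual
  adjB : (n : ℕ) → Vert n → Vert n → Bool
  adjB zero (inj₁ a) (inj₁ b) = not ⌊ a ≟ b ⌋
  adjB (suc zero) (inj₁ a) (inj₁ b) = not ⌊ a ≟ b ⌋
  adjB (suc (suc n)) x y =
    adjMaybe (suc n) (restrict n c0 x) (restrict n c0 y)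
      ∨ (adjMaybe (suc n) (restrict n c1 x) (restrict n c1 y)
      ∨ adjMaybe (suc n) (restrict n c2 x) (restrict n c2 y))

  adjMaybe : (n : ℕ) → Maybe (Vert n) → Maybe (Vert n) → Bool
  adjMaybe n (just a) (just b) = adjB n a b
  adjMaybe n _ _ = false

distinct-sound : ∀ (a b : Fin 3) → not ⌊ a ≟ b ⌋ ≡ true → a ≢ b
distinct-sound a b e with a ≟ b
... | no h = h

distinct-complete : ∀ (a b : Fin 3) → a ≢ b → not ⌊ a ≟ b ⌋ ≡ true
distinct-complete a b h with a ≟ b
... | yes e = ⊥-elim (h e)
... | no _ = refl

adjInCopy-sound : ∀ n i x y → (∀ a b → adjB (suc n) a b ≡ true → Adj (suc n) a b) →
  adjMaybe (suc n) (restrict n i x) (restrict n i y) ≡ true → Adj (suc (suc n)) x y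
adjInCopy-sound n i x y sound e with restrict n i x in ex | restrict n i y in ey
... | just a | just b = i , a , b , sound a b e , emb-restrict n i x a ex , emb-restrict n i y b ey

adjCopies-sound : ∀ n x y → (∀ a b → adjB (suc n) a b ≡ true → Adj (suc n) a b) →
  adjB (suc (suc n)) x y ≡ true → Adj (suc (suc n)) x y
adjCopies-sound n x y sound e with ∨-true _ _ e
... | inj₁ e0 = adjInCopy-sound n c0 x y sound e0
... | inj₂ e' with ∨-true _ _ e'
...   | inj₁ e1 = adjInCopy-sound n c1 x y sound e1
...   | inj₂ e2 = adjInCopy-sound n c2 x y sound e2

adjB-sound : ∀ n x y → adjB n x y ≡ true → Adj n x y
adjB-sound zero (inj₁ a) (inj₁ b) e = distinct-sound a b e
adjB-sound (suc zero) (inj₁ a) (inj₁ b) e = distinct-sound a b e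
adjB-sound (suc (suc n)) x y e = adjCopies-sound n x y (adjB-sound (suc n)) e

adjInCopy-complete : ∀ n i a b → adjB (suc n) a b ≡ true → adjB (suc (suc n)) (emb n i a) (emb n i b) ≡ true
adjInCopy-complete n i a b h = detect i
  where
  found : ∀ i → adjMaybe (suc n) (restrict n i (emb n i a)) (restrict n i (emb n i b)) ≡ true
  found i rewrite restrict-emb n i a | restrict-emb n i b = h
  detect : ∀ i → adjB (suc (suc n)) (emb n i a) (emb n i b) ≡ true
  detect c0 rewrite found c0 = refl
  detect c1 rewrite found c1 = ∨-zeroʳ _
  detect c2 rewrite found c2 | ∨-zeroʳ (adjMaybe (suc n) (restrict n c1 (emb n c2 a)) (restrict n c1 (emb n c2 b))) = ∨-zeroʳ _

adjB-complete : ∀ n x y → Adj n x y → adjB n x y ≡ true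
adjB-complete zero (inj₁ a) (inj₁ b) h = distinct-complete a b h
adjB-complete (suc zero) (inj₁ a) (inj₁ b) h = distinct-complete a b h
adjB-complete (suc (suc n)) x y (i , a , b , h , refl , refl) =
  adjInCopy-complete n i a b (adjB-complete (suc n) a b h)

adjB-false : ∀ n x y → adjB n x y ≡ false → ¬ Adj n x y
adjB-false n x y e h = true≢false (trans (sym (adjB-complete n x y h)) e)

adj? : ∀ n x y → Dec (Adj n x y)
adj? n x y with adjB n x y in e
... | true = yes (adjB-sound n x y e)
... | false = no (adjB-false n x y e)

Adj-sym : ∀ n x y → Adj n x y → Adj n y x
Adj-sym zero (inj₁ a) (inj₁ b) h = ≢-sym h
Adj-sym (suc zero) (inj₁ a) (inj₁ b) h = ≢-sym h
Adj-sym (suc (suc n)) x y (i , a , b , h , e1 , e2) = i , b , a , Adj-sym (suc n) a b h , e2 , e1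

Adj-irrefl : ∀ n x → ¬ Adj n x x
Adj-irrefl zero (inj₁ a) h = h refl
Adj-irrefl (suc zero) (inj₁ a) h = h refl
Adj-irrefl (suc (suc n)) x (i , a , b , h , e1 , e2) =
  Adj-irrefl (suc n) a (subst (Adj (suc n) a) (sym (emb-injective n i a b (trans e1 (sym e2)))) h)

-- For n ≥ 2 the extreme vertices are pairwise non-adjacent (they lie in
-- different copies).
extremes-nonadjacent : ∀ n i j → i ≢ j → ¬ Adj (suc (suc n)) (inj₁ i) (inj₁ j)
extremes-nonadjacent n i j h (l , a , b , _ , e1 , e2) =
  h (trans (sym (proj₁ (emb-to-extreme n l a i e1))) (proj₁ (emb-to-extreme n l b j e2)))

emb-reflects-adj : ∀ n i a b → Adj (suc (suc n)) (emb n i a) (emb n i b) → Adj (suc n) a b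
emb-reflects-adj n i a b (j , a' , b' , h , e1 , e2) with j ≟ i
... | yes refl = subst₂ (Adj (suc n)) (emb-injective n i a' a e1) (emb-injective n i b' b e2) h
... | no hj = ⊥-elim (Adj-irrefl (suc n) a' (subst (Adj (suc n) a') a'≡b' h))
  where
  a'≡b' : b' ≡ a'
  a'≡b' = trans (proj₂ (copies-meet n i j b b' (≢-sym hj) e2)) (sym (proj₂ (copies-meet n i j a a' (≢-sym hj) e1)))

emb-local : ∀ n i x u → Adj (suc (suc n)) (emb n i x) u → (∃[ v ] x ≡ inj₂ v) ⊎ x ≡ inj₁ i →
  ∃[ a ] (u ≡ emb n i a)
emb-local n i x u (j , a' , b' , h , e1 , e2) notShared with j ≟ i
... | yes refl = b' , sym e2
... | no hj with copies-meet n i j x a' (≢-sym hj) e1 | notShared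
...   | () , _ | inj₁ (v , refl)
...   | e , _ | inj₂ refl = ⊥-elim (hj (sym (inj₁-injective e)))

extreme-adj-in-copy : ∀ n p x → Adj (suc (suc n)) (inj₁ p) (emb n p x) → Adj (suc n) (inj₁ p) x
extreme-adj-in-copy n p x h =
  emb-reflects-adj n p (inj₁ p) x (subst (λ z → Adj (suc (suc n)) z (emb n p x)) (sym (emb-same n p)) h)

extreme-nonadj-copy : ∀ n p q x → p ≢ q → ¬ Adj (suc (suc (suc n))) (inj₁ q) (emb (suc n) p x)
extreme-nonadj-copy n p q x h (i , a , b , h' , e1 , e2) with emb-to-extreme (suc n) i a q e1
... | refl , refl with copies-meet (suc n) p i x b h e2
... | refl , refl = extremes-nonadjacent n q p (≢-sym h) h'

allFin3-complete : ∀ i → i ∈ allFin3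
allFin3-complete c0 = here refl
allFin3-complete c1 = there (here refl)
allFin3-complete c2 = there (there (here refl))

allFin3-unique : Unique allFin3
allFin3-unique = ((λ ()) ∷ (λ ()) ∷ []) ∷ ((λ ()) ∷ []) ∷ [] ∷ []

inCopy : ∀ n → Fin 3 → NE (suc n) → NE (suc (suc n))
inCopy n i v = inj₂ (i , v)

allNE-complete : ∀ n v → v ∈ allNE n
allNE-complete (suc (suc n)) (inj₁ k) = ∈-++⁺ˡ (∈-map⁺ inj₁ (allFin3-complete k))
allNE-complete (suc (suc n)) (inj₂ (i , v)) = ∈-++⁺ʳ (map inj₁ allFin3) (inCopies i)
  where
  copy : ∀ j → List (NE (suc (suc n)))
  copy j = map (inCopy n j) (allNE (suc n))
  inCopies : ∀ i → inj₂ (i , v) ∈ copy c0 ++ copy c1 ++ copy c2 ++ []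
  inCopies c0 = ∈-++⁺ˡ (∈-map⁺ (inCopy n c0) (allNE-complete (suc n) v))
  inCopies c1 = ∈-++⁺ʳ (copy c0) (∈-++⁺ˡ (∈-map⁺ (inCopy n c1) (allNE-complete (suc n) v)))
  inCopies c2 = ∈-++⁺ʳ (copy c0) (∈-++⁺ʳ (copy c1) (∈-++⁺ˡ (∈-map⁺ (inCopy n c2) (allNE-complete (suc n) v))))

allVert-complete : ∀ n v → v ∈ allVert n
allVert-complete n (inj₁ k) = ∈-++⁺ˡ (∈-map⁺ inj₁ (allFin3-complete k))
allVert-complete n (inj₂ v) = ∈-++⁺ʳ (map inj₁ allFin3) (∈-map⁺ inj₂ (allNE-complete n v))

disjoint-map : ∀ {A B C : Set} (g : A → C) (h : B → C) → (∀ a b → g a ≢ h b) →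
  ∀ xs ys → Disjoint (map g xs) (map h ys)
disjoint-map g h apart xs ys (p , q) with ∈-map⁻ g p | ∈-map⁻ h q
... | a , _ , e1 | b , _ , e2 = apart a b (trans (sym e1) e2)

disjoint-++ : ∀ {A : Set} (xs ys zs : List A) → Disjoint xs ys → Disjoint xs zs → Disjoint xs (ys ++ zs)
disjoint-++ xs ys zs d1 d2 (p , q) with ∈-++⁻ ys q
... | inj₁ q1 = d1 (p , q1)
... | inj₂ q2 = d2 (p , q2)

disjoint-[] : ∀ {A : Set} (xs : List A) → Disjoint xs []
disjoint-[] xs (_ , ())

copies-unique : ∀ n → Unique (allNE (suc n)) → Unique (allNE (suc (suc n)))
copies-unique n U =
  Unique.++⁺ (Unique.map⁺ inj₁-injective allFin3-unique)
    (Unique.++⁺ (copyU c0)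
      (Unique.++⁺ (copyU c1) (Unique.++⁺ (copyU c2) [] (disjoint-[] _))
        (disjoint-++ _ _ _ (apart c1 c2 (λ ())) (disjoint-[] _)))
      (disjoint-++ _ _ _ (apart c0 c1 (λ ())) (disjoint-++ _ _ _ (apart c0 c2 (λ ())) (disjoint-[] _))))
    (disjoint-++ _ _ _ (shared c0) (disjoint-++ _ _ _ (shared c1) (disjoint-++ _ _ _ (shared c2) (disjoint-[] _))))
  where
  L = allNE (suc n)
  copyU : ∀ i → Unique (map (inCopy n i) L)
  copyU i = Unique.map⁺ (λ e → proj₂ (Product.,-injective (inj₂-injective e))) U
  apart : ∀ i j → i ≢ j → Disjoint (map (inCopy n i) L) (map (inCopy n j) L)
  apart i j h = disjoint-map (inCopy n i) (inCopy n j)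
    (λ a b e → h (proj₁ (Product.,-injective (inj₂-injective e)))) L L
  shared : ∀ i → Disjoint (map inj₁ allFin3) (map (inCopy n i) L)
  shared i = disjoint-map inj₁ (inCopy n i) (λ a b ()) allFin3 L

allNE-unique : ∀ n → Unique (allNE n)
allNE-unique zero = []
allNE-unique (suc zero) = []
allNE-unique (suc (suc n)) = copies-unique n (allNE-unique (suc n))

allVert-unique : ∀ n → Unique (allVert n)
allVert-unique n = Unique.++⁺ (Unique.map⁺ inj₁-injective allFin3-unique) (Unique.map⁺ inj₂-injective (allNE-unique n))
  (disjoint-map inj₁ inj₂ (λ a b ()) allFin3 (allNE n))

_≟V_ : ∀ {n} → DecidableEquality (Vert n)
_≟V_ {n} = Sum.≡-dec _≟_ (_≟NE_ {n})
  where
  _≟NE_ : ∀ {n} → DecidableEquality (NE n)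
  _≟NE_ {suc (suc n)} = Sum.≡-dec _≟_ (Product.≡-dec _≟_ (_≟NE_ {suc n}))

mem : ∀ {n} → List (Vert n) → VSet n
mem [] v = false
mem (a ∷ A) v = ⌊ v ≟V a ⌋ ∨ mem A v

mem-sound : ∀ {n} (A : List (Vert n)) v → mem A v ≡ true → v ∈ A
mem-sound (a ∷ A) v e with v ≟V a
... | yes refl = here refl
... | no _ = there (mem-sound A v e)

mem-complete : ∀ {n} (A : List (Vert n)) v → v ∈ A → mem A v ≡ true
mem-complete (a ∷ A) v (here refl) with v ≟V v
... | yes _ = refl
... | no h = ⊥-elim (h refl)
mem-complete (a ∷ A) v (there m) with v ≟V a
... | yes _ = refl
... | no _ = mem-complete A v m

mem-false : ∀ {n} (A : List (Vert n)) v → v ∉ A → mem A v ≡ false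
mem-false A v h with mem A v in e
... | true = ⊥-elim (h (mem-sound A v e))
... | false = refl

IndependentList : (n : ℕ) → List (Vert n) → Set
IndependentList n A = ∀ a b → a ∈ A → b ∈ A → ¬ Adj n a b

Covered : (n : ℕ) → List (Vert n) → Vert n → Set
Covered n A v = Any (λ a → InClosedNbhd n a v) A

covered? : ∀ n A v → Dec (Covered n A v)
covered? n A v = any? (λ a → (v ≟V a) ⊎-dec adj? n a v) A

module Greedy (n : ℕ) (D : Vert n → Bool) where

  hasNbr : Vert n → List (Vert n) → Bool
  hasNbr v M = any (λ m → adjB n m v) M

  hasNbr-sound : ∀ v M → hasNbr v M ≡ true → ∃[ m ] (m ∈ M × Adj n m v)
  hasNbr-sound v M e with any-sound _ M e
  ... | m , i , a = m , i , adjB-sound n m v a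

  hasNbr-false : ∀ v M → hasNbr v M ≡ false → ∀ m → m ∈ M → ¬ Adj n m v
  hasNbr-false v M e m i = adjB-false n m v (any-false _ M m e i)

  greedy : List (Vert n) → List (Vert n) → List (Vert n)
  greedy [] M = M
  greedy (v ∷ vs) M = if D v ∧ not (hasNbr v M) then greedy vs (v ∷ M) else greedy vs M

  Allowed : List (Vert n) → Set
  Allowed M = (∀ m → m ∈ M → D m ≡ true) × IndependentList n M

  greedy-allowed : ∀ vs M → Allowed M → Allowed (greedy vs M)
  greedy-allowed [] M I = I
  greedy-allowed (v ∷ vs) M I with D v in eD | hasNbr v M in eA
  ... | true | false = greedy-allowed vs (v ∷ M) (allowed , independent)
    where
    allowed : ∀ m → m ∈ v ∷ M → D m ≡ true
    allowed m (here refl) = eD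
    allowed m (there i) = proj₁ I m i
    independent : IndependentList n (v ∷ M)
    independent m m' (here refl) (here refl) = Adj-irrefl n m
    independent m m' (here refl) (there j) a = hasNbr-false v M eA m' j (Adj-sym n m m' a)
    independent m m' (there i) (here refl) a = hasNbr-false v M eA m i a
    independent m m' (there i) (there j) = proj₂ I m m' i j
  ... | true | true = greedy-allowed vs M I
  ... | false | _ = greedy-allowed vs M I

  greedy-keeps : ∀ vs M m → m ∈ M → m ∈ greedy vs M
  greedy-keeps [] M m i = i
  greedy-keeps (v ∷ vs) M m i with D v ∧ not (hasNbr v M)
  ... | true = greedy-keeps vs (v ∷ M) m (there i)
  ... | false = greedy-keeps vs M m i

  greedy-dominates : ∀ vs M v → v ∈ vs → D v ≡ true →
    v ∈ greedy vs M ⊎ ∃[ m ] (m ∈ greedy vs M × Adj n m v)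
  greedy-dominates (v ∷ vs) M .v (here refl) eD with hasNbr v M in eA
  ... | false rewrite eD = inj₁ (greedy-keeps vs (v ∷ M) v (here refl))
  ... | true rewrite eD with hasNbr-sound v M eA
  ...   | m , i , a = inj₂ (m , greedy-keeps vs M m i , a)
  greedy-dominates (w ∷ vs) M v (there j) eD with D w ∧ not (hasNbr w M)
  ... | true = greedy-dominates vs (w ∷ M) v j eD
  ... | false = greedy-dominates vs M v j eD

-- Every independent list B extends to a maximal independent set by a set M
-- depending only on N[B]: take a maximal independent set of the vertices
-- outside N[A], for any A with N[A] = N[B].
module Extension (n : ℕ) (A : List (Vert n)) where

  outside : Vert n → Bool
  outside v = not ⌊ covered? n A v ⌋

  outside-sound : ∀ v → outside v ≡ true → ¬ Covered n A v
  outside-sound v e c with covered? n A v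
  outside-sound v () c | yes _
  ... | no nc = nc c

  outside-complete : ∀ v → ¬ Covered n A v → outside v ≡ true
  outside-complete v nc with covered? n A v
  ... | yes c = ⊥-elim (nc c)
  ... | no _ = refl

  open Greedy n outside

  M : List (Vert n)
  M = greedy (allVert n) []

  M-allowed : Allowed M
  M-allowed = greedy-allowed (allVert n) [] ((λ m ()) , (λ m m' ()))

  module _ (B : List (Vert n)) (indB : IndependentList n B)
           (A⊆B : ∀ v → Covered n A v → Covered n B v)
           (B⊆A : ∀ v → Covered n B v → Covered n A v) where

    S : VSet n
    S v = mem B v ∨ mem M v

    S-cases : ∀ v → S v ≡ true → v ∈ B ⊎ v ∈ M
    S-cases v e with ∨-true _ _ e
    ... | inj₁ e1 = inj₁ (mem-sound B v e1)
    ... | inj₂ e2 = inj₂ (mem-sound M v e2)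

    S-B : ∀ v → v ∈ B → S v ≡ true
    S-B v i rewrite mem-complete B v i = refl

    S-M : ∀ v → v ∈ M → S v ≡ true
    S-M v i rewrite mem-complete M v i = ∨-zeroʳ (mem B v)

    M-outside : ∀ m → m ∈ M → ¬ Covered n B m
    M-outside m i c = outside-sound m (proj₁ M-allowed m i) (B⊆A m c)

    S-independent : Independent n S
    S-independent u v eu ev with S-cases u eu | S-cases v ev
    ... | inj₁ iu | inj₁ iv = indB u v iu iv
    ... | inj₁ iu | inj₂ iv = λ a → M-outside v iv (lose iu (inj₂ a))
    ... | inj₂ iu | inj₁ iv = λ a → M-outside u iu (lose iv (inj₂ (Adj-sym n u v a)))
    ... | inj₂ iu | inj₂ iv = proj₂ M-allowed u v iu iv

    S-maximal : ∀ T → Independent n T → S ⊆ T → T ⊆ S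
    S-maximal T indT sub v eT with S v in eS
    ... | true = refl
    ... | false with covered? n B v
    ...   | yes c with find c
    ...     | b , ib , inj₁ refl = ⊥-elim (true≢false (trans (sym (S-B b ib)) eS))
    ...     | b , ib , inj₂ adj = ⊥-elim (indT b v (sub b (S-B b ib)) eT adj)
    S-maximal T indT sub v eT | false | no nc
      with greedy-dominates (allVert n) [] v (allVert-complete n v) (outside-complete v (λ c → nc (A⊆B v c)))
    ... | inj₁ iM = ⊥-elim (true≢false (trans (sym (S-M v iM)) eS))
    ... | inj₂ (m , iM , adj) = ⊥-elim (indT m v (sub m (S-M m iM)) eT adj)

    S-MIS : MIS n S
    S-MIS = S-independent , S-maximal

    B-M-disjoint : ∀ v → mem B v ∧ mem M v ≡ false
    B-M-disjoint v with mem B v in e1 | mem M v in e2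
    ... | false | _ = refl
    ... | true | false = refl
    ... | true | true = ⊥-elim (M-outside v (mem-sound M v e2) (lose (mem-sound B v e1) (inj₁ refl)))

-- Weights.
module Weights {c ℓ} (F : Field c ℓ) where

  open Field F using (Carrier; _≈_; _+_; 0#; setoid; +-cong; +-identityˡ; +-identityʳ;
    +-assoc; +-commutativeSemigroup; +-abelianGroup)
    renaming (refl to ≈-refl; sym to ≈-sym; trans to ≈-trans)
  open import Relation.Binary.Reasoning.Setoid setoid
  open import Algebra.Properties.CommutativeSemigroup +-commutativeSemigroup using (interchange)
  open import Algebra.Bundles using (AbelianGroup)
  open import Algebra.Properties.Group (AbelianGroup.group +-abelianGroup) using (∙-cancelʳ)

  module _ {n : ℕ} (f : Vert n → Carrier) where

    weightOn : List (Vert n) → VSet n → Carrier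
    weightOn L S = foldr (λ v acc → (if S v then f v else 0#) + acc) 0# L

    Σf : List (Vert n) → Carrier
    Σf [] = 0#
    Σf (a ∷ A) = f a + Σf A

    Σf-++ : ∀ A B → Σf (A ++ B) ≈ Σf A + Σf B
    Σf-++ [] B = ≈-sym (+-identityˡ _)
    Σf-++ (a ∷ A) B = ≈-trans (+-cong ≈-refl (Σf-++ A B)) (≈-sym (+-assoc _ _ _))

    weightOn-∨ : ∀ L S T → (∀ v → S v ∧ T v ≡ false) →
      weightOn L (λ v → S v ∨ T v) ≈ weightOn L S + weightOn L T
    weightOn-∨ [] S T d = ≈-sym (+-identityʳ 0#)
    weightOn-∨ (v ∷ L) S T d = ≈-trans (+-cong (split (S v) (T v) (d v)) (weightOn-∨ L S T d)) (interchange _ _ _ _)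
      where
      split : ∀ a b → a ∧ b ≡ false →
        (if a ∨ b then f v else 0#) ≈ (if a then f v else 0#) + (if b then f v else 0#)
      split true false _ = ≈-sym (+-identityʳ (f v))
      split false true _ = ≈-sym (+-identityˡ (f v))
      split false false _ = ≈-sym (+-identityˡ 0#)

    weightOn-empty : ∀ L S → (∀ v → v ∈ L → S v ≡ false) → weightOn L S ≈ 0#
    weightOn-empty [] S h = ≈-refl
    weightOn-empty (v ∷ L) S h rewrite h v (here refl) =
      ≈-trans (+-identityˡ _) (weightOn-empty L S (λ u i → h u (there i)))

    weightOn-singleton : ∀ L a → Unique L → a ∈ L → weightOn L (λ v → ⌊ v ≟V a ⌋) ≈ f a
    weightOn-singleton (x ∷ L) .x (x∉L ∷ U) (here refl) with x ≟V x
    ... | yes _ = ≈-trans (+-cong ≈-refl (weightOn-empty L _ notX)) (+-identityʳ (f x))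
      where
      notX : ∀ u → u ∈ L → ⌊ u ≟V x ⌋ ≡ false
      notX u i with u ≟V x
      ... | yes refl = ⊥-elim (All.lookup x∉L i refl)
      ... | no _ = refl
    ... | no h = ⊥-elim (h refl)
    weightOn-singleton (x ∷ L) a (x∉L ∷ U) (there i) with x ≟V a
    ... | yes e = ⊥-elim (All.lookup x∉L i e)
    ... | no _ = ≈-trans (+-identityˡ _) (weightOn-singleton L a U i)

    weight-mem : ∀ A → Unique A → weight F n f (mem A) ≈ Σf A
    weight-mem [] UA = weightOn-empty (allVert n) _ (λ _ _ → refl)
    weight-mem (a ∷ A) (a∉A ∷ UA) =
      ≈-trans (weightOn-∨ (allVert n) (λ v → ⌊ v ≟V a ⌋) (mem A) disjoint)
        (+-cong (weightOn-singleton (allVert n) a (allVert-unique n) (allVert-complete n a)) (weight-mem A UA))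
      where
      disjoint : ∀ v → ⌊ v ≟V a ⌋ ∧ mem A v ≡ false
      disjoint v with v ≟V a
      ... | no _ = refl
      ... | yes refl = mem-false A v (λ i → All.lookup a∉A i refl)

    -- Exchange lemma: for a well-covered weighting, two duplicate-free
    -- independent lists with the same closed neighbourhood have the same
    -- weight (extend both by the same set M to maximal independent sets).
    exchange : WellCovered F n f → ∀ A B → Unique A → Unique B →
      IndependentList n A → IndependentList n B →
      (∀ v → Covered n A v → Covered n B v) → (∀ v → Covered n B v → Covered n A v) →
      Σf A ≈ Σf B
    exchange wc A B UA UB indA indB A⊆B B⊆A = ∙-cancelʳ (W (mem M)) (Σf A) (Σf B) (begin
      Σf A + W (mem M)                 ≈⟨ +-cong (≈-sym (weight-mem A UA)) ≈-refl ⟩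
      W (mem A) + W (mem M)            ≈⟨ ≈-sym (weightOn-∨ (allVert n) (mem A) (mem M) (B-M-disjoint A indA self self)) ⟩
      W (S A indA self self)           ≈⟨ wc _ _ (S-MIS A indA self self) (S-MIS B indB A⊆B B⊆A) ⟩
      W (S B indB A⊆B B⊆A)             ≈⟨ weightOn-∨ (allVert n) (mem B) (mem M) (B-M-disjoint B indB A⊆B B⊆A) ⟩
      W (mem B) + W (mem M)            ≈⟨ +-cong (weight-mem B UB) ≈-refl ⟩
      Σf B + W (mem M)                 ∎)
      where
      open Extension n A
      W : VSet n → Carrier
      W = weight F n f
      self : ∀ v → Covered n A v → Covered n A v
      self _ c = c

-- Only the images of the extreme vertices may have outside neighbours.
record Copy (m N : ℕ) : Set where
  field
    E : Vert m → Vert N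
    injective : ∀ a b → E a ≡ E b → a ≡ b
    adj⁺ : ∀ a b → Adj m a b → Adj N (E a) (E b)
    adj⁻ : ∀ a b → Adj N (E a) (E b) → Adj m a b
    nonExtreme : ∀ v → ∃[ w ] (E (inj₂ v) ≡ inj₂ w)
    local : ∀ v u → Adj N (E (inj₂ v)) u → ∃[ a ] (u ≡ E a)

ClosedAt : ∀ {m N} → Copy m N → Fin 3 → Set
ClosedAt C j = ∀ u → Adj _ (Copy.E C (inj₁ j)) u → ∃[ a ] (u ≡ Copy.E C a)

copy-id : ∀ m → Copy m m
copy-id m = record
  { E = λ x → x ; injective = λ a b e → e ; adj⁺ = λ a b h → h ; adj⁻ = λ a b h → h
  ; nonExtreme = λ v → v , refl ; local = λ v u h → u , refl }

copy-emb : ∀ n i → Copy (suc n) (suc (suc n))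
copy-emb n i = record
  { E = emb n i
  ; injective = emb-injective n i
  ; adj⁺ = λ a b h → i , a , b , h , refl , refl
  ; adj⁻ = emb-reflects-adj n i
  ; nonExtreme = λ v → inj₂ (i , v) , refl
  ; local = λ v u h → emb-local n i (inj₂ v) u h (inj₁ (v , refl)) }

copy-emb-closed : ∀ n i → ClosedAt (copy-emb n i) i
copy-emb-closed n i u h = emb-local n i (inj₁ i) u h (inj₂ refl)

copy-∘ : ∀ {k m N} → Copy k N → Copy m k → Copy m N
copy-∘ {k} {m} {N} C D = record
  { E = λ x → C.E (D.E x)
  ; injective = λ a b e → D.injective a b (C.injective _ _ e)
  ; adj⁺ = λ a b h → C.adj⁺ _ _ (D.adj⁺ a b h)
  ; adj⁻ = λ a b h → D.adj⁻ a b (C.adj⁻ _ _ h)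
  ; nonExtreme = nonExtreme
  ; local = local }
  where
  module C = Copy C
  module D = Copy D
  nonExtreme : ∀ v → ∃[ w ] (C.E (D.E (inj₂ v)) ≡ inj₂ w)
  nonExtreme v with D.nonExtreme v
  ... | w , e rewrite e = C.nonExtreme w
  local : ∀ v u → Adj N (C.E (D.E (inj₂ v))) u → ∃[ a ] (u ≡ C.E (D.E a))
  local v u h with D.nonExtreme v
  ... | w , e with C.local w u (subst (λ z → Adj N (C.E z) u) e h)
  ...   | b , refl with D.local v b (C.adj⁻ _ _ h)
  ...     | a , refl = a , refl

copy-∘-closed : ∀ {k m N} (C : Copy k N) (D : Copy m k) j j' → Copy.E D (inj₁ j) ≡ inj₁ j' →
  ClosedAt D j → ClosedAt C j' → ClosedAt (copy-∘ C D) j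
copy-∘-closed {N = N} C D j j' e closedD closedC u h with closedC u (subst (λ z → Adj N (Copy.E C z) u) e h)
... | b , refl with closedD b (Copy.adj⁻ C _ _ h)
...   | a , refl = a , refl

cornerCopy : (q : Fin 3) → (m : ℕ) → Copy 3 (3 +ℕ m)
cornerCopy q zero = copy-id 3
cornerCopy q (suc m) = copy-∘ (copy-emb (2 +ℕ m) q) (cornerCopy q m)

cornerCopy-extreme : ∀ q m → Copy.E (cornerCopy q m) (inj₁ q) ≡ inj₁ q
cornerCopy-extreme q zero = refl
cornerCopy-extreme q (suc m) rewrite cornerCopy-extreme q m = emb-same (2 +ℕ m) q

cornerCopy-closed : ∀ q m → ClosedAt (cornerCopy q m) q
cornerCopy-closed q zero u h = u , refl
cornerCopy-closed q (suc m) =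
  copy-∘-closed (copy-emb (2 +ℕ m) q) (cornerCopy q m) q q (cornerCopy-extreme q m)
    (cornerCopy-closed q m) (copy-emb-closed (2 +ℕ m) q)

-- `sideNbr n p q` is the neighbour of p on the side from p to q
-- (meaningful for n ≥ 2): it is the vertex shared by copies p and q of
-- the corner copy of S_2 at p.
sideNbr : (n : ℕ) → Fin 3 → Fin 3 → Vert n
sideNbr zero p q = inj₁ p
sideNbr (suc zero) p q = inj₁ p
sideNbr (suc (suc zero)) p q = inj₂ (inj₁ (third p q))
sideNbr (suc (suc (suc n))) p q = emb (suc n) p (sideNbr (suc (suc n)) p q)

cornerCopy-sideNbr : ∀ q p m → Copy.E (cornerCopy q m) (sideNbr 3 q p) ≡ sideNbr (3 +ℕ m) q p
cornerCopy-sideNbr q p zero = refl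
cornerCopy-sideNbr q p (suc m) rewrite cornerCopy-sideNbr q p m = refl

-- A window into S_N consists of a finite shape -- a list of points with
-- boolean tests for "same vertex" and "adjacent", and a flag marking the
-- points whose image may have neighbours outside the window -- together
-- with a map R into S_N for which the tests are correct and every point
-- that is not open has its whole neighbourhood in the window.  Then
-- closed-neighbourhood questions about images can be decided locally.
record Shape : Set₁ where
  field
    X : Set
    points : List X
    points-complete : ∀ x → x ∈ points
    sameB : X → X → Bool
    adjW : X → X → Bool
    open? : X → Bool

record Window (N : ℕ) (S : Shape) : Set₁ where
  open Shape S public
  field
    R : X → Vert N
    sameB-sound : ∀ x y → sameB x y ≡ true → R x ≡ R y
    sameB-complete : ∀ x y → R x ≡ R y → sameB x y ≡ true
    adjW-sound : ∀ x y → adjW x y ≡ true → Adj N (R x) (R y)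
    adjW-complete : ∀ x y → Adj N (R x) (R y) → adjW x y ≡ true
    closed : ∀ x u → open? x ≡ false → Adj N (R x) u → ∃[ y ] (u ≡ R y)

-- Boolean certificates, on a shape, for the hypotheses of the exchange
-- lemma on two lists A, B of points; they are checked by evaluation.
module Certificates (S : Shape) where
  open Shape S

  independentB : List X → Bool
  independentB A = all (λ a → all (λ b → not (adjW a b)) A) A

  uniqueB : List X → Bool
  uniqueB [] = true
  uniqueB (a ∷ A) = all (λ b → not (sameB a b)) A ∧ uniqueB A

  coveredB : List X → X → Bool
  coveredB A y = any (λ a → sameB a y ∨ adjW a y) A

  coversB : List X → List X → Bool
  coversB A B = all (λ y → not (coveredB A y) ∨ coveredB B y) points

  openInB : List X → List X → Bool
  openInB A B = all (λ a → not (open? a) ∨ any (sameB a) B) A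

  certifies : List X → List X → Bool
  certifies A B = independentB A ∧ independentB B ∧ uniqueB A ∧ uniqueB B
    ∧ coversB A B ∧ coversB B A ∧ openInB A B ∧ openInB B A

record Swap (S : Shape) : Set where
  field
    lhs rhs common : List (Shape.X S)
    valid : Certificates.certifies S (lhs ++ common) (rhs ++ common) ≡ true

module CertificatesSound {N : ℕ} {S : Shape} (W : Window N S) where
  open Window W
  open Certificates S

  unique-sound : ∀ A → uniqueB A ≡ true → Unique (map R A)
  unique-sound [] _ = []
  unique-sound (a ∷ A) e with ∧-true _ _ e
  ... | fresh , rest = AllP.map⁺ (All.tabulate distinct) ∷ unique-sound A rest
    where
    distinct : ∀ {b} → b ∈ A → R a ≢ R b
    distinct {b} i eq = true≢false (trans (sym (sameB-complete a b eq)) (not-true (all-sound _ A b fresh i)))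

  independent-sound : ∀ A → independentB A ≡ true → IndependentList N (map R A)
  independent-sound A e u v iu iv h with ∈-map⁻ R iu | ∈-map⁻ R iv
  ... | a , ia , refl | b , ib , refl =
    true≢false (trans (sym (adjW-complete a b h)) (not-true (all-sound _ A b (all-sound _ A a e ia) ib)))

  coveredB-sound : ∀ B y → coveredB B y ≡ true → Covered N (map R B) (R y)
  coveredB-sound B y e with any-sound _ B e
  ... | b , ib , h with ∨-true _ _ h
  ...   | inj₁ same = AnyP.map⁺ (lose ib (inj₁ (sym (sameB-sound b y same))))
  ...   | inj₂ adj = AnyP.map⁺ (lose ib (inj₂ (adjW-sound b y adj)))

  coveredB-complete : ∀ A a y → a ∈ A → InClosedNbhd N (R a) (R y) → coveredB A y ≡ true
  coveredB-complete A a y ia (inj₁ eq) = any-complete _ A a ia (subst (λ z → z ∨ adjW a y ≡ true)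
    (sym (sameB-complete a y (sym eq))) refl)
  coveredB-complete A a y ia (inj₂ adj) = any-complete _ A a ia (subst (λ z → sameB a y ∨ z ≡ true)
    (sym (adjW-complete a y adj)) (∨-zeroʳ _))

  inside : ∀ a u → open? a ≡ false → InClosedNbhd N (R a) u → ∃[ y ] (u ≡ R y)
  inside a u _ (inj₁ eq) = a , eq
  inside a u notOpen (inj₂ adj) = closed a u notOpen adj

  covers-sound : ∀ A B → coversB A B ≡ true → openInB A B ≡ true →
    ∀ u → Covered N (map R A) u → Covered N (map R B) u
  covers-sound A B covers opens u c with find (AnyP.map⁻ c)
  ... | a , ia , nbhd with open? a in eo
  ...   | true with any-sound _ B (implies (all-sound _ A a opens ia) eo)
  ...     | b , ib , same = AnyP.map⁺ (lose ib (subst (λ z → InClosedNbhd N z u) (sameB-sound a b same) nbhd))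
  covers-sound A B covers opens u c | a , ia , nbhd | false with inside a u eo nbhd
  ...     | y , refl = coveredB-sound B y
            (implies (all-sound _ points y covers (points-complete y)) (coveredB-complete A a y ia nbhd))

  certifies-sound : ∀ A B → certifies A B ≡ true →
    Unique (map R A) × Unique (map R B) ×
    IndependentList N (map R A) × IndependentList N (map R B) ×
    (∀ u → Covered N (map R A) u → Covered N (map R B) u) × (∀ u → Covered N (map R B) u → Covered N (map R A) u)
  certifies-sound A B e with ∧-true _ _ e
  ... | iA , e1 with ∧-true _ _ e1
  ... | iB , e2 with ∧-true _ _ e2
  ... | uA , e3 with ∧-true _ _ e3
  ... | uB , e4 with ∧-true _ _ e4
  ... | cAB , e5 with ∧-true _ _ e5
  ... | cBA , e6 with ∧-true _ _ e6
  ... | oAB , oBA = unique-sound A uA , unique-sound B uB , independent-sound A iA , independent-sound B iB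
                  , covers-sound A B cAB oAB , covers-sound B A cBA oBA

sameV : Vert 3 → Vert 3 → Bool
sameV x y = ⌊ _≟V_ {3} x y ⌋

sameV-sound : ∀ x y → sameV x y ≡ true → x ≡ y
sameV-sound x y e with _≟V_ {3} x y
... | yes h = h

sameV-refl : ∀ x → sameV x x ≡ true
sameV-refl x with _≟V_ {3} x x
... | yes _ = refl
... | no h = ⊥-elim (h refl)

indistinct : ∀ (j k : Fin 3) → not ⌊ j ≟ k ⌋ ≡ false → j ≡ k
indistinct j k e with j ≟ k
... | yes h = h

copyShape : (Fin 3 → Bool) → Shape
copyShape op = record
  { X = Vert 3 ; points = allVert 3 ; points-complete = allVert-complete 3
  ; sameB = sameV ; adjW = adjB 3 ; open? = extremeFlag }
  where
  extremeFlag : Vert 3 → Bool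
  extremeFlag (inj₁ j) = op j
  extremeFlag (inj₂ _) = false

copyWindow : ∀ {N} (C : Copy 3 N) (op : Fin 3 → Bool) → (∀ j → op j ≡ false → ClosedAt C j) →
  Window N (copyShape op)
copyWindow {N} C op closedAt = record
  { R = Copy.E C
  ; sameB-sound = λ x y e → cong (Copy.E C) (sameV-sound x y e)
  ; sameB-complete = λ x y e → subst (λ z → sameV x z ≡ true) (Copy.injective C x y e) (sameV-refl x)
  ; adjW-sound = λ x y e → Copy.adj⁺ C x y (adjB-sound 3 x y e)
  ; adjW-complete = λ x y h → adjB-complete 3 x y (Copy.adj⁻ C x y h)
  ; closed = closed }
  where
  closed : ∀ x u → Shape.open? (copyShape op) x ≡ false → Adj N (Copy.E C x) u → ∃[ y ] (u ≡ Copy.E C y)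
  closed (inj₁ j) u e h = closedAt j e u h
  closed (inj₂ v) u e h = Copy.local C v u h

-- The window given by two copies of S_3 sharing one vertex: the extreme
-- vertex q of the first (left) copy is the extreme vertex p of the second
-- (right) copy; all other extreme vertices are open.
pairShape : Fin 3 → Fin 3 → Shape
pairShape p q = record
  { X = Vert 3 ⊎ Vert 3 ; points = map inj₁ (allVert 3) ++ map inj₂ (allVert 3)
  ; points-complete = complete ; sameB = same ; adjW = adjacent ; open? = openFlag }
  where
  complete : ∀ x → x ∈ map inj₁ (allVert 3) ++ map inj₂ (allVert 3)
  complete (inj₁ x) = ∈-++⁺ˡ (∈-map⁺ inj₁ (allVert-complete 3 x))
  complete (inj₂ x) = ∈-++⁺ʳ (map inj₁ (allVert 3)) (∈-map⁺ inj₂ (allVert-complete 3 x))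
  same : Vert 3 ⊎ Vert 3 → Vert 3 ⊎ Vert 3 → Bool
  same (inj₁ x) (inj₁ y) = sameV x y
  same (inj₂ x) (inj₂ y) = sameV x y
  same (inj₁ x) (inj₂ y) = sameV x (inj₁ q) ∧ sameV y (inj₁ p)
  same (inj₂ y) (inj₁ x) = sameV y (inj₁ p) ∧ sameV x (inj₁ q)
  adjacent : Vert 3 ⊎ Vert 3 → Vert 3 ⊎ Vert 3 → Bool
  adjacent (inj₁ x) (inj₁ y) = adjB 3 x y
  adjacent (inj₂ x) (inj₂ y) = adjB 3 x y
  adjacent (inj₁ x) (inj₂ y) = (adjB 3 x (inj₁ q) ∧ sameV y (inj₁ p)) ∨ (sameV x (inj₁ q) ∧ adjB 3 (inj₁ p) y)
  adjacent (inj₂ y) (inj₁ x) = (adjB 3 y (inj₁ p) ∧ sameV x (inj₁ q)) ∨ (sameV y (inj₁ p) ∧ adjB 3 (inj₁ q) x)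
  openFlag : Vert 3 ⊎ Vert 3 → Bool
  openFlag (inj₁ (inj₁ j)) = not ⌊ j ≟ q ⌋
  openFlag (inj₂ (inj₁ j)) = not ⌊ j ≟ p ⌋
  openFlag (inj₁ (inj₂ _)) = false
  openFlag (inj₂ (inj₂ _)) = false

junction-nbrs : ∀ n p q w → p ≢ q → Adj (suc (suc n)) (emb n p (inj₁ q)) w →
  (∃[ b ] (w ≡ emb n p b × Adj (suc n) (inj₁ q) b)) ⊎ (∃[ b ] (w ≡ emb n q b × Adj (suc n) (inj₁ p) b))
junction-nbrs n p q w h (i , a , b , ab , e1 , e2) with i ≟ p
... | yes refl = inj₁ (b , sym e2 , subst (λ z → Adj (suc n) z b) (emb-injective n i a (inj₁ q) e1) ab)
... | no hp with i ≟ q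
...   | yes refl = inj₂ (b , sym e2 , subst (λ z → Adj (suc n) z b) (proj₂ (copies-meet n p i (inj₁ i) a h e1)) ab)
...   | no hq = ⊥-elim (hq (sym (inj₁-injective (proj₁ (copies-meet n p i (inj₁ q) a (≢-sym hp) e1)))))

∧-intro : ∀ {a b} → a ≡ true → b ≡ true → a ∧ b ≡ true
∧-intro refl refl = refl

-- Inside a copy E of S_{4+m}: the corner copy of S_3 at q inside copy p,
-- and the corner copy of S_3 at p inside copy q.  They share the vertex
-- of E where copies p and q meet, and form a window of shape pairShape p q.
module CornerPair {N : ℕ} (m : ℕ) (E : Copy (4 +ℕ m) N) (p q : Fin 3) (pq : p ≢ q) where

  private
    n' : ℕ
    n' = suc (suc m)
    module E = Copy E
    module H1 = Copy (cornerCopy q m)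
    module H2 = Copy (cornerCopy p m)
    qp : q ≢ p
    qp = ≢-sym pq

  left : Copy 3 N
  left = copy-∘ E (copy-∘ (copy-emb n' p) (cornerCopy q m))

  right : Copy 3 N
  right = copy-∘ E (copy-∘ (copy-emb n' q) (cornerCopy p m))

  L R′ : Vert 3 → Vert N
  L = Copy.E left
  R′ = Copy.E right

  shared : L (inj₁ q) ≡ R′ (inj₁ p)
  shared = cong E.E (trans (cong (emb n' p) (cornerCopy-extreme q m))
    (trans (emb-junction n' p q pq) (cong (emb n' q) (sym (cornerCopy-extreme p m)))))

  private
    junctionE : emb n' p (H1.E (inj₁ q)) ≡ inj₂ (inj₁ (third p q))
    junctionE = trans (cong (emb n' p) (cornerCopy-extreme q m)) (emb-diff n' p q pq)

  meet : ∀ x y → L x ≡ R′ y → x ≡ inj₁ q × y ≡ inj₁ p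
  meet x y e with copies-meet n' q p (H2.E y) (H1.E x) qp (E.injective _ _ e)
  ... | a1 , a2 = H1.injective x (inj₁ q) (trans a2 (sym (cornerCopy-extreme q m)))
                , H2.injective y (inj₁ p) (trans a1 (sym (cornerCopy-extreme p m)))

  cross-adj : ∀ x y → Adj N (L x) (R′ y) →
    (Adj 3 x (inj₁ q) × y ≡ inj₁ p) ⊎ (x ≡ inj₁ q × Adj 3 (inj₁ p) y)
  cross-adj x y h with E.adj⁻ _ _ h
  ... | i , a , b , ab , k1 , k2 with i ≟ p
  ...   | yes refl with copies-meet n' q i (H2.E y) b qp k2
  ...     | g1 , g2 = inj₁ (H1.adj⁻ x (inj₁ q)
                (subst₂ (Adj (3 +ℕ m)) (emb-injective n' i a (H1.E x) k1) (trans g2 (sym (cornerCopy-extreme q m))) ab)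
              , H2.injective y (inj₁ p) (trans g1 (sym (cornerCopy-extreme p m))))
  cross-adj x y h | i , a , b , ab , k1 , k2 | no hp with i ≟ q
  ...   | yes refl with copies-meet n' p i (H1.E x) a pq k1
  ...     | g1 , g2 = inj₂ (H1.injective x (inj₁ q) (trans g1 (sym (cornerCopy-extreme q m)))
              , H2.adj⁻ (inj₁ p) y
                (subst₂ (Adj (3 +ℕ m)) (trans g2 (sym (cornerCopy-extreme p m))) (emb-injective n' i b (H2.E y) k2) ab))
  cross-adj x y h | i , a , b , ab , k1 , k2 | no hp | no hq
    with copies-meet n' p i (H1.E x) a (≢-sym hp) k1 | copies-meet n' q i (H2.E y) b (≢-sym hq) k2
  ... | _ , g2 | _ , g4 = ⊥-elim (extremes-nonadjacent (suc m) p q pq (subst₂ (Adj (3 +ℕ m)) g2 g4 ab))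

  realise : Vert 3 ⊎ Vert 3 → Vert N
  realise (inj₁ x) = L x
  realise (inj₂ y) = R′ y

  open Shape (pairShape p q)

  same-sound : ∀ x y → sameB x y ≡ true → realise x ≡ realise y
  same-sound (inj₁ x) (inj₁ y) e = cong L (sameV-sound x y e)
  same-sound (inj₂ x) (inj₂ y) e = cong R′ (sameV-sound x y e)
  same-sound (inj₁ x) (inj₂ y) e with ∧-true (sameV x (inj₁ q)) (sameV y (inj₁ p)) e
  ... | ex , ey = subst₂ (λ a b → L a ≡ R′ b) (sym (sameV-sound x _ ex)) (sym (sameV-sound y _ ey)) shared
  same-sound (inj₂ y) (inj₁ x) e with ∧-true (sameV y (inj₁ p)) (sameV x (inj₁ q)) e
  ... | ey , ex = subst₂ (λ a b → R′ b ≡ L a) (sym (sameV-sound x _ ex)) (sym (sameV-sound y _ ey)) (sym shared)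

  same-complete : ∀ x y → realise x ≡ realise y → sameB x y ≡ true
  same-complete (inj₁ x) (inj₁ y) e = subst (λ z → sameV x z ≡ true) (Copy.injective left x y e) (sameV-refl x)
  same-complete (inj₂ x) (inj₂ y) e = subst (λ z → sameV x z ≡ true) (Copy.injective right x y e) (sameV-refl x)
  same-complete (inj₁ x) (inj₂ y) e with meet x y e
  ... | refl , refl = ∧-intro (sameV-refl (inj₁ q)) (sameV-refl (inj₁ p))
  same-complete (inj₂ y) (inj₁ x) e with meet x y (sym e)
  ... | refl , refl = ∧-intro (sameV-refl (inj₁ p)) (sameV-refl (inj₁ q))

  adj-sound : ∀ x y → adjW x y ≡ true → Adj N (realise x) (realise y)
  adj-sound (inj₁ x) (inj₁ y) e = Copy.adj⁺ left x y (adjB-sound 3 x y e)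
  adj-sound (inj₂ x) (inj₂ y) e = Copy.adj⁺ right x y (adjB-sound 3 x y e)
  adj-sound (inj₁ x) (inj₂ y) e with ∨-true (adjB 3 x (inj₁ q) ∧ sameV y (inj₁ p)) (sameV x (inj₁ q) ∧ adjB 3 (inj₁ p) y) e
  ... | inj₁ h with ∧-true (adjB 3 x (inj₁ q)) (sameV y (inj₁ p)) h
  ...   | a , ey = subst (λ b → Adj N (L x) (R′ b)) (sym (sameV-sound y _ ey))
          (subst (Adj N (L x)) shared (Copy.adj⁺ left x (inj₁ q) (adjB-sound 3 x (inj₁ q) a)))
  adj-sound (inj₁ x) (inj₂ y) e | inj₂ h with ∧-true (sameV x (inj₁ q)) (adjB 3 (inj₁ p) y) h
  ...   | ex , a = subst (λ b → Adj N (L b) (R′ y)) (sym (sameV-sound x _ ex))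
          (subst (λ z → Adj N z (R′ y)) (sym shared) (Copy.adj⁺ right (inj₁ p) y (adjB-sound 3 (inj₁ p) y a)))
  adj-sound (inj₂ y) (inj₁ x) e with ∨-true (adjB 3 y (inj₁ p) ∧ sameV x (inj₁ q)) (sameV y (inj₁ p) ∧ adjB 3 (inj₁ q) x) e
  ... | inj₁ h with ∧-true (adjB 3 y (inj₁ p)) (sameV x (inj₁ q)) h
  ...   | a , ex = subst (λ b → Adj N (R′ y) (L b)) (sym (sameV-sound x _ ex))
          (subst (Adj N (R′ y)) (sym shared) (Copy.adj⁺ right y (inj₁ p) (adjB-sound 3 y (inj₁ p) a)))
  adj-sound (inj₂ y) (inj₁ x) e | inj₂ h with ∧-true (sameV y (inj₁ p)) (adjB 3 (inj₁ q) x) h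
  ...   | ey , a = subst (λ b → Adj N (R′ b) (L x)) (sym (sameV-sound y _ ey))
          (subst (λ z → Adj N z (L x)) shared (Copy.adj⁺ left (inj₁ q) x (adjB-sound 3 (inj₁ q) x a)))

  adj-complete : ∀ x y → Adj N (realise x) (realise y) → adjW x y ≡ true
  adj-complete (inj₁ x) (inj₁ y) h = adjB-complete 3 x y (Copy.adj⁻ left x y h)
  adj-complete (inj₂ x) (inj₂ y) h = adjB-complete 3 x y (Copy.adj⁻ right x y h)
  adj-complete (inj₁ x) (inj₂ y) h with cross-adj x y h
  ... | inj₁ (a , refl) rewrite adjB-complete 3 x (inj₁ q) a | sameV-refl (inj₁ p) = refl
  ... | inj₂ (refl , a) rewrite adjB-complete 3 (inj₁ p) y a | sameV-refl (inj₁ q) = ∨-zeroʳ _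
  adj-complete (inj₂ y) (inj₁ x) h with cross-adj x y (Adj-sym N _ _ h)
  ... | inj₁ (a , refl) rewrite adjB-complete 3 (inj₁ q) x (Adj-sym 3 x (inj₁ q) a) | sameV-refl (inj₁ p) = ∨-zeroʳ _
  ... | inj₂ (refl , a) rewrite adjB-complete 3 y (inj₁ p) (Adj-sym 3 (inj₁ p) y a) | sameV-refl (inj₁ q) = refl

  shared-closed : ∀ u → Adj N (L (inj₁ q)) u → ∃[ y ] (u ≡ realise y)
  shared-closed u h with E.local (inj₁ (third p q)) u (subst (λ z → Adj N (E.E z) u) junctionE h)
  ... | w , refl with junction-nbrs n' p q w pq (subst (λ z → Adj (4 +ℕ m) z w) (sym (emb-diff n' p q pq))
                        (E.adj⁻ _ _ (subst (λ z → Adj N (E.E z) (E.E w)) junctionE h)))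
  ...   | inj₁ (b , refl , ab) with cornerCopy-closed q m b (subst (λ z → Adj (3 +ℕ m) z b) (sym (cornerCopy-extreme q m)) ab)
  ...     | y , refl = inj₁ y , refl
  shared-closed u h | w , refl | inj₂ (b , refl , ab)
    with cornerCopy-closed p m b (subst (λ z → Adj (3 +ℕ m) z b) (sym (cornerCopy-extreme p m)) ab)
  ...     | y , refl = inj₂ y , refl

  closed : ∀ x u → open? x ≡ false → Adj N (realise x) u → ∃[ y ] (u ≡ realise y)
  closed (inj₁ (inj₁ j)) u e h with indistinct j q e
  ... | refl = shared-closed u h
  closed (inj₂ (inj₁ j)) u e h with indistinct j p e
  ... | refl = shared-closed u (subst (λ z → Adj N z u) (sym shared) h)
  closed (inj₁ (inj₂ v)) u e h with Copy.local left v u h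
  ... | y , eq = inj₁ y , eq
  closed (inj₂ (inj₂ v)) u e h with Copy.local right v u h
  ... | y , eq = inj₂ y , eq

  window : Window N (pairShape p q)
  window = record
    { R = realise
    ; sameB-sound = same-sound ; sameB-complete = same-complete
    ; adjW-sound = adj-sound ; adjW-complete = adj-complete ; closed = closed }

-- Named vertices of S_3: the vertex shared by the two copies other than
-- copy k, and the vertex of copy i shared by its two sub-copies other
-- than sub-copy k.
junction : Fin 3 → Vert 3
junction k = inj₂ (inj₁ k)

inner : Fin 3 → Fin 3 → Vert 3
inner i k = inj₂ (inj₂ (i , inj₁ k))

swapFamily : (S : Fin 3 → Fin 3 → Shape) (lhs rhs common : ∀ p q → List (Shape.X (S p q))) →
  (∀ p q → p ≢ q → Certificates.certifies (S p q) (lhs p q ++ common p q) (rhs p q ++ common p q) ≡ true) →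
  ∀ p q → p ≢ q → Swap (S p q)
swapFamily S lhs rhs common valid p q pq = record
  { lhs = lhs p q ; rhs = rhs p q ; common = common p q ; valid = valid p q pq }

-- The exchanges used below, with r = third p q, J k = junction k and
-- I i k = inner i k.  In S_3, open at every extreme vertex:

allOpen : Fin 3 → Fin 3 → Shape
allOpen _ _ = copyShape (λ _ → true)

middleSwap₁ : ∀ p q → p ≢ q → Swap (copyShape (λ _ → true))
middleSwap₁ = swapFamily allOpen (λ p q → junction (third p q) ∷ []) (λ p q → inner p p ∷ [])
  (λ p q → inj₁ p ∷ inj₁ q ∷ junction p ∷ inner (third p q) q ∷ [])
  (forDistinct _ refl refl refl refl refl refl)

middleSwap₂ : ∀ p q → p ≢ q → Swap (copyShape (λ _ → true))
middleSwap₂ = swapFamily allOpen (λ p q → junction p ∷ junction q ∷ []) (λ p q → inner (third p q) (third p q) ∷ [])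
  (λ p q → inner p (third p q) ∷ inner q (third p q) ∷ [])
  (forDistinct _ refl refl refl refl refl refl)

middleSwap₃ : ∀ p q → p ≢ q → Swap (copyShape (λ _ → true))
middleSwap₃ = swapFamily allOpen (λ p q → junction p ∷ []) (λ p q → inner (third p q) (third p q) ∷ [])
  (λ p q → inj₁ (third p q) ∷ inner p p ∷ inner q (third p q) ∷ [])
  (forDistinct _ refl refl refl refl refl refl)

middleSwap₄ : ∀ p q → p ≢ q → Swap (copyShape (λ _ → true))
middleSwap₄ = swapFamily allOpen (λ p q → junction q ∷ []) (λ p q → inner p p ∷ [])
  (λ p q → inj₁ p ∷ inj₁ (third p q) ∷ junction p ∷ inner q (third p q) ∷ [])
  (forDistinct _ refl refl refl refl refl refl)

extremeSwap : ∀ p q → p ≢ q → Swap (copyShape (λ j → not ⌊ j ≟ p ⌋))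
extremeSwap = swapFamily (λ p _ → copyShape (λ j → not ⌊ j ≟ p ⌋))
  (λ p q → inj₁ p ∷ []) (λ p q → inner p (third p q) ∷ []) (λ p q → junction q ∷ inner q q ∷ [])
  (forDistinct _ refl refl refl refl refl refl)

pairSwap₁ : ∀ p q → p ≢ q → Swap (pairShape p q)
pairSwap₁ = swapFamily pairShape (λ p q → inj₁ (junction p) ∷ []) (λ p q → inj₁ (inner q q) ∷ [])
  (λ p q → inj₁ (inj₁ q) ∷ inj₁ (inner p p) ∷ inj₁ (inner (third p q) q) ∷ [])
  (forDistinct _ refl refl refl refl refl refl)

pairSwap₂ : ∀ p q → p ≢ q → Swap (pairShape p q)
pairSwap₂ = swapFamily pairShape (λ p q → inj₁ (inner q p) ∷ []) (λ p q → inj₁ (inner q q) ∷ [])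
  (λ p q → inj₁ (inner p p) ∷ inj₂ (inner p q) ∷ [])
  (forDistinct _ refl refl refl refl refl refl)

pairSwap₃ : ∀ p q → p ≢ q → Swap (pairShape p q)
pairSwap₃ = swapFamily pairShape (λ p q → inj₁ (inj₁ q) ∷ inj₁ (junction p) ∷ []) (λ p q → inj₁ (inner q p) ∷ [])
  (λ p q → inj₁ (inner (third p q) q) ∷ inj₂ (inner p p) ∷ [])
  (forDistinct _ refl refl refl refl refl refl)

pairSwap₄ : ∀ p q → p ≢ q → Swap (pairShape p q)
pairSwap₄ = swapFamily pairShape (λ p q → inj₁ (inj₁ q) ∷ []) (λ p q → inj₁ (inner q (third q p)) ∷ [])
  (λ p q → inj₁ (junction p) ∷ inj₁ (inner p p) ∷ inj₂ (inner p p) ∷ [])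
  (forDistinct _ refl refl refl refl refl refl)

module LocalFacts {c ℓ} (F : Field c ℓ) where

  open Field F using (Carrier; _≈_; _+_; 0#; +-cong; +-identityˡ; +-identityʳ; +-abelianGroup; setoid)
    renaming (refl to ≈-refl; reflexive to ≈-reflexive; sym to ≈-sym; trans to ≈-trans)
  open import Relation.Binary.Reasoning.Setoid setoid
  open import Algebra.Bundles using (AbelianGroup)
  open import Algebra.Properties.Group (AbelianGroup.group +-abelianGroup) using (∙-cancelˡ; ∙-cancelʳ)
  open Weights F

  module _ {N : ℕ} (f : Vert N → Carrier) (wc : WellCovered F N f) where

    certified-exchange : ∀ {S} (W : Window N S) (σ : Swap S) →
      Σf f (map (Window.R W) (Swap.lhs σ)) ≈ Σf f (map (Window.R W) (Swap.rhs σ))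
    certified-exchange W σ =
      ∙-cancelʳ (Σf f (map R common)) _ _ (≈-trans (≈-sym (split lhs)) (≈-trans exchanged (split rhs)))
      where
      open Swap σ
      open Window W using (R)
      exchanged : Σf f (map R (lhs ++ common)) ≈ Σf f (map R (rhs ++ common))
      exchanged = let uA , uB , iA , iB , A⊆B , B⊆A = CertificatesSound.certifies-sound W (lhs ++ common) (rhs ++ common) valid
                  in exchange f wc _ _ uA uB iA iB A⊆B B⊆A
      split : ∀ D → Σf f (map R (D ++ common)) ≈ Σf f (map R D) + Σf f (map R common)
      split D = ≈-trans (≈-reflexive (cong (Σf f) (map-++ R D common))) (Σf-++ f (map R D) (map R common))

    private
      strip : ∀ {x y} → x + 0# ≈ y + 0# → x ≈ y
      strip {x} {y} h = ≈-trans (≈-sym (+-identityʳ x)) (≈-trans h (+-identityʳ y))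

    middle-zero : (C : Copy 3 N) → ∀ p q → p ≢ q → f (Copy.E C (junction (third p q))) ≈ 0#
    middle-zero C p q pq = begin
      f (E (junction r))      ≈⟨ strip (certified-exchange W (middleSwap₁ p q pq)) ⟩
      f (E (inner p p))       ≈⟨ ≈-sym (strip (certified-exchange W (middleSwap₄ p q pq))) ⟩
      f (E (junction q))      ≈⟨ ≈-sym (+-identityʳ _) ⟩
      f (E (junction q)) + 0# ≈⟨ ∙-cancelˡ (f (E (junction p))) _ _ sum≈ ⟩
      0#                      ∎
      where
      W = copyWindow C (λ _ → true) (λ j ())
      E = Copy.E C
      r = third p q
      -- f(J p) + f(J q) = f(I r r) = f(J p)
      sum≈ : f (E (junction p)) + (f (E (junction q)) + 0#) ≈ f (E (junction p)) + 0#
      sum≈ = ≈-trans (certified-exchange W (middleSwap₂ p q pq))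
        (+-cong (≈-sym (strip (certified-exchange W (middleSwap₃ p q pq)))) ≈-refl)

    extreme≈sideNbr : (C : Copy 3 N) → ∀ p q → p ≢ q → ClosedAt C p →
      f (Copy.E C (inj₁ p)) ≈ f (Copy.E C (sideNbr 3 p q))
    extreme≈sideNbr C p q pq closedAt = strip (certified-exchange W (extremeSwap p q pq))
      where
      W = copyWindow C (λ j → not ⌊ j ≟ p ⌋) (λ j e → subst (ClosedAt C) (sym (indistinct j p e)) closedAt)

    module _ (m : ℕ) (E : Copy (4 +ℕ m) N) (p q : Fin 3) (pq : p ≢ q) where
      open CornerPair m E p q pq using (window; L)

      private
        -- f(shared) + f(J p) = f(I q p) = f(I q q) = f(J p)
        sum≈ : f (L (inj₁ q)) + (f (L (junction p)) + 0#) ≈ 0# + (f (L (junction p)) + 0#)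
        sum≈ = begin
          f (L (inj₁ q)) + (f (L (junction p)) + 0#) ≈⟨ certified-exchange window (pairSwap₃ p q pq) ⟩
          f (L (inner q p)) + 0#                     ≈⟨ +-identityʳ _ ⟩
          f (L (inner q p))                          ≈⟨ strip (certified-exchange window (pairSwap₂ p q pq)) ⟩
          f (L (inner q q))                          ≈⟨ ≈-sym (strip (certified-exchange window (pairSwap₁ p q pq))) ⟩
          f (L (junction p))                         ≈⟨ ≈-sym (+-identityʳ _) ⟩
          f (L (junction p)) + 0#                    ≈⟨ ≈-sym (+-identityˡ _) ⟩
          0# + (f (L (junction p)) + 0#)             ∎
        shared-zero : f (L (inj₁ q)) ≈ 0#
        shared-zero = ∙-cancelʳ _ _ _ sum≈

      junction-zero : f (Copy.E E (emb (2 +ℕ m) p (inj₁ q))) ≈ 0#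
      junction-zero = subst (λ z → f (Copy.E E (emb (2 +ℕ m) p z)) ≈ 0#) (cornerCopy-extreme q m) shared-zero

      junctionNbr-zero : f (Copy.E E (emb (2 +ℕ m) p (sideNbr (3 +ℕ m) q p))) ≈ 0#
      junctionNbr-zero = subst (λ z → f (Copy.E E (emb (2 +ℕ m) p z)) ≈ 0#) (cornerCopy-sideNbr q p m)
        (≈-trans (≈-sym (strip (certified-exchange window (pairSwap₄ p q pq)))) shared-zero)

side-S₃ : ∀ p q → p ≢ q →
  side 3 p q ≡ inj₁ p ∷ sideNbr 3 p q ∷ junction (third p q) ∷ sideNbr 3 q p ∷ inj₁ q ∷ []
side-S₃ = forDistinct _ refl refl refl refl refl refl

middle-nonadjacent : ∀ p q → p ≢ q →
  adjB 3 (inj₁ p) (junction (third p q)) ≡ false × adjB 3 (inj₁ q) (junction (third p q)) ≡ false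
middle-nonadjacent = forDistinct _ (refl , refl) (refl , refl) (refl , refl) (refl , refl) (refl , refl) (refl , refl)

extreme-adj-sideNbr : ∀ m p q → p ≢ q → Adj (3 +ℕ m) (inj₁ p) (sideNbr (3 +ℕ m) p q)
extreme-adj-sideNbr zero p q pq = adjB-sound 3 _ _ (forDistinct (λ p q → adjB 3 (inj₁ p) (sideNbr 3 p q) ≡ true)
  refl refl refl refl refl refl p q pq)
extreme-adj-sideNbr (suc m) p q pq = subst (λ z → Adj (4 +ℕ m) z (sideNbr (4 +ℕ m) p q)) (emb-same (2 +ℕ m) p)
  (Copy.adj⁺ (copy-emb (2 +ℕ m) p) (inj₁ p) (sideNbr (3 +ℕ m) p q) (extreme-adj-sideNbr m p q pq))

-- Extreme vertices are simplicial: in S_3 by an exhaustive check, and in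
-- S_{n+1} because the closed neighbourhood of p lies in copy p.
extreme-simplicial : ∀ m p → Simplicial (3 +ℕ m) (inj₁ p)
extreme-simplicial zero p a b pa pb ab =
  adjB-sound 3 a b (otherwise (implies (implies test (adjB-complete 3 _ _ pa)) (adjB-complete 3 _ _ pb)) notSame)
  where
  cliqueTest : Fin 3 → Vert 3 → Vert 3 → Bool
  cliqueTest p a b = not (adjB 3 (inj₁ p) a) ∨ not (adjB 3 (inj₁ p) b) ∨ sameV a b ∨ adjB 3 a b
  checked : ∀ p → all (λ a → all (cliqueTest p a) (allVert 3)) (allVert 3) ≡ true
  checked c0 = refl
  checked c1 = refl
  checked c2 = refl
  test : cliqueTest p a b ≡ true
  test = all-sound (cliqueTest p a) (allVert 3) b
    (all-sound (λ a → all (cliqueTest p a) (allVert 3)) (allVert 3) a (checked p) (allVert-complete 3 a))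
    (allVert-complete 3 b)
  notSame : sameV a b ≡ false
  notSame with sameV a b in e
  ... | true = ⊥-elim (ab (sameV-sound a b e))
  ... | false = refl
  otherwise : ∀ {x y} → x ∨ y ≡ true → x ≡ false → y ≡ true
  otherwise e refl = e
extreme-simplicial (suc m) p a b pa pb ab
  with copy-emb-closed (2 +ℕ m) p a (subst (λ z → Adj (4 +ℕ m) z a) (sym (emb-same (2 +ℕ m) p)) pa)
     | copy-emb-closed (2 +ℕ m) p b (subst (λ z → Adj (4 +ℕ m) z b) (sym (emb-same (2 +ℕ m) p)) pb)
... | a' , refl | b' , refl =
  Copy.adj⁺ (copy-emb (2 +ℕ m) p) a' b' (extreme-simplicial m p a' b'
    (extreme-adj-in-copy (2 +ℕ m) p a' pa) (extreme-adj-in-copy (2 +ℕ m) p b' pb)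
    (λ e → ab (cong (emb (2 +ℕ m) p) e)))

∈-drop₁ : ∀ {A : Set} (xs : List A) {v} → v ∈ drop 1 xs → v ∈ xs
∈-drop₁ (x ∷ xs) i = there i

module SideClassification {c ℓ} (F : Field c ℓ) {N : ℕ} (f : Vert N → Field.Carrier F)
                          (wc : WellCovered F N f) where

  open Field F using (Carrier; _≈_; 0#)
  open LocalFacts F

  EndOf : ∀ n → Fin 3 → Fin 3 → Vert n → Set
  EndOf n a b v = v ≡ inj₁ a ⊎ v ≡ sideNbr n a b

  Interior : ∀ {n} → Copy n N → Fin 3 → Fin 3 → Vert n → Set ℓ
  Interior {n} C p q v = f (Copy.E C v) ≈ 0# × ¬ Adj n (inj₁ p) v × ¬ Adj n (inj₁ q) v

  SideClass : ∀ {n} → Copy n N → Fin 3 → Fin 3 → Vert n → Set ℓ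
  SideClass {n} C p q v = EndOf n p q v ⊎ EndOf n q p v ⊎ Interior C p q v

  sideClass-swap : ∀ {n} (C : Copy n N) {p q v} → SideClass C p q v → SideClass C q p v
  sideClass-swap C (inj₁ e) = inj₂ (inj₁ e)
  sideClass-swap C (inj₂ (inj₁ e)) = inj₁ e
  sideClass-swap C (inj₂ (inj₂ (z , np , nq))) = inj₂ (inj₂ (z , nq , np))

  interior-in-copy : ∀ m (C : Copy (4 +ℕ m) N) a b → a ≢ b → ∀ v →
    f (Copy.E C (emb (2 +ℕ m) a v)) ≈ 0# → ¬ Adj (3 +ℕ m) (inj₁ a) v → SideClass C a b (emb (2 +ℕ m) a v)
  interior-in-copy m C a b ab v z na =
    inj₂ (inj₂ (z , (λ h → na (extreme-adj-in-copy (2 +ℕ m) a v h)) , extreme-nonadj-copy (suc m) a b v ab))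

  -- From copy a of a copy C of S_{4+m} to C: the end at a and the interior
  -- stay what they are, while the end at b of copy a consists of the vertex
  -- shared with copy b and its side neighbour, both of weight zero.
  transfer : ∀ m (C : Copy (4 +ℕ m) N) a b → a ≢ b → ∀ v →
    SideClass (copy-∘ C (copy-emb (2 +ℕ m) a)) a b v → SideClass C a b (emb (2 +ℕ m) a v)
  transfer m C a b ab v (inj₁ (inj₁ refl)) = inj₁ (inj₁ (emb-same (2 +ℕ m) a))
  transfer m C a b ab v (inj₁ (inj₂ refl)) = inj₁ (inj₂ refl)
  transfer m C a b ab v (inj₂ (inj₁ (inj₁ refl))) =
    interior-in-copy m C a b ab v (junction-zero f wc m C a b ab) (extremes-nonadjacent (suc m) a b ab)
  transfer m C a b ab v (inj₂ (inj₁ (inj₂ refl))) =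
    interior-in-copy m C a b ab v (junctionNbr-zero f wc m C a b ab)
      (extreme-nonadj-copy m b a (sideNbr (2 +ℕ m) b a) (≢-sym ab))
  transfer m C a b ab v (inj₂ (inj₂ (z , na , _))) = interior-in-copy m C a b ab v z na

  classify : ∀ m (C : Copy (3 +ℕ m) N) p q → p ≢ q → ∀ v → v ∈ side (3 +ℕ m) p q → SideClass C p q v
  classify zero C p q pq v i rewrite side-S₃ p q pq with i
  ... | here refl = inj₁ (inj₁ refl)
  ... | there (here refl) = inj₁ (inj₂ refl)
  ... | there (there (here refl)) = inj₂ (inj₂ (middle-zero f wc C p q pq
        , adjB-false 3 _ _ (proj₁ (middle-nonadjacent p q pq)) , adjB-false 3 _ _ (proj₂ (middle-nonadjacent p q pq))))
  ... | there (there (there (here refl))) = inj₂ (inj₁ (inj₂ refl))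
  ... | there (there (there (there (here refl)))) = inj₂ (inj₁ (inj₁ refl))
  classify (suc m) C p q pq v i with ∈-++⁻ (map (emb (2 +ℕ m) p) (side (3 +ℕ m) p q)) i
  ... | inj₁ inLeft with ∈-map⁻ (emb (2 +ℕ m) p) inLeft
  ...   | v' , iv , refl = transfer m C p q pq v' (classify m (copy-∘ C (copy-emb (2 +ℕ m) p)) p q pq v' iv)
  classify (suc m) C p q pq v i | inj₂ inRight with ∈-map⁻ (emb (2 +ℕ m) q) (∈-drop₁ _ inRight)
  ...   | v' , iv , refl = sideClass-swap C (transfer m C q p (≢-sym pq) v'
          (sideClass-swap (copy-∘ C (copy-emb (2 +ℕ m) q)) (classify m (copy-∘ C (copy-emb (2 +ℕ m) q)) p q pq v' iv)))

module SideWeights {c ℓ} (F : Field c ℓ) (m : ℕ) (f : Vert (3 +ℕ m) → Field.Carrier F)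
                   (wc : WellCovered F (3 +ℕ m) f) where

  open Field F using (_≈_; 0#) renaming (refl to ≈-refl; sym to ≈-sym; trans to ≈-trans)
  open LocalFacts F
  open SideClassification F f wc

  side-class : ∀ p q → p ≢ q → ∀ v → v ∈ side (3 +ℕ m) p q → SideClass (copy-id (3 +ℕ m)) p q v
  side-class = classify m (copy-id (3 +ℕ m))

  end-simplicial : ∀ a b → a ≢ b → ∀ v → EndOf (3 +ℕ m) a b v → InSimplicialClique (3 +ℕ m) v
  end-simplicial a b ab v (inj₁ e) = inj₁ a , extreme-simplicial m a , inj₁ e
  end-simplicial a b ab v (inj₂ refl) = inj₁ a , extreme-simplicial m a , inj₂ (extreme-adj-sideNbr m a b ab)

  off-cliques-zero : ∀ p q → p ≢ q → ∀ v → v ∈ side (3 +ℕ m) p q → ¬ InSimplicialClique (3 +ℕ m) v → f v ≈ 0#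
  off-cliques-zero p q pq v i notInClique with side-class p q pq v i
  ... | inj₁ e = ⊥-elim (notInClique (end-simplicial p q pq v e))
  ... | inj₂ (inj₁ e) = ⊥-elim (notInClique (end-simplicial q p (≢-sym pq) v e))
  ... | inj₂ (inj₂ (vanishes , _ , _)) = vanishes

  -- the neighbour of a on the side weighs as much as a (corner copy of S_3 at a)
  sideNbr≈extreme : ∀ a b → a ≢ b → f (sideNbr (3 +ℕ m) a b) ≈ f (inj₁ a)
  sideNbr≈extreme a b ab = ≈-sym (subst₂ (λ x y → f x ≈ f y) (cornerCopy-extreme a m) (cornerCopy-sideNbr a b m)
    (extreme≈sideNbr f wc (cornerCopy a m) a b ab (cornerCopy-closed a m)))

  far-end : ∀ a b → a ≢ b → ∀ u → EndOf (3 +ℕ m) b a u → ¬ InClosedNbhd (3 +ℕ m) (inj₁ a) u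
  far-end a b ab u (inj₁ refl) (inj₁ e) = ab (sym (inj₁-injective e))
  far-end a b ab u (inj₁ refl) (inj₂ adj) = extremes-nonadjacent (suc m) a b ab adj
  far-end a b ab u (inj₂ refl) (inj₁ e) = ab (sym (proj₁ (emb-to-extreme (suc m) b (sideNbr (2 +ℕ m) b a) a e)))
  far-end a b ab u (inj₂ refl) (inj₂ adj) = extreme-nonadj-copy m b a (sideNbr (2 +ℕ m) b a) (≢-sym ab) adj

  near-end-weight : ∀ a b → a ≢ b → ∀ u → SideClass (copy-id (3 +ℕ m)) a b u →
    InClosedNbhd (3 +ℕ m) (inj₁ a) u → f u ≈ f (inj₁ a)
  near-end-weight a b ab u _ (inj₁ refl) = ≈-refl
  near-end-weight a b ab u (inj₁ (inj₁ refl)) _ = ≈-refl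
  near-end-weight a b ab u (inj₁ (inj₂ refl)) _ = sideNbr≈extreme a b ab
  near-end-weight a b ab u (inj₂ (inj₁ e)) nbhd = ⊥-elim (far-end a b ab u e nbhd)
  near-end-weight a b ab u (inj₂ (inj₂ (_ , notAdj , _))) (inj₂ adj) = ⊥-elim (notAdj adj)

  end-weights-equal : ∀ p q a b → a ≢ b → (∀ v → v ∈ side (3 +ℕ m) p q → SideClass (copy-id (3 +ℕ m)) a b v) →
    ∀ u w → u ∈ side (3 +ℕ m) p q → w ∈ side (3 +ℕ m) p q →
    InClosedNbhd (3 +ℕ m) (inj₁ a) u → InClosedNbhd (3 +ℕ m) (inj₁ a) w → f u ≈ f w
  end-weights-equal p q a b ab class u w iu iw nu nw =
    ≈-trans (near-end-weight a b ab u (class u iu) nu) (≈-sym (near-end-weight a b ab w (class w iw) nw))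

mainTheorem9 : ∀ {c ℓ} (F : Field c ℓ) (n : ℕ) → 3 ≤ n →
    (f : Vert n → Field.Carrier F) → WellCovered F n f →
    (p q : Fin 3) → p ≢ q →
      (∀ v → v ∈ side n p q → ¬ InSimplicialClique n v → Field._≈_ F (f v) (Field.0# F))
      × (∀ u w → u ∈ side n p q → w ∈ side n p q →
           InClosedNbhd n (inj₁ p) u → InClosedNbhd n (inj₁ p) w → Field._≈_ F (f u) (f w))
      × (∀ u w → u ∈ side n p q → w ∈ side n p q →
           InClosedNbhd n (inj₁ q) u → InClosedNbhd n (inj₁ q) w → Field._≈_ F (f u) (f w))
mainTheorem9 F (suc (suc (suc m))) (s≤s (s≤s (s≤s z≤n))) f wc p q pq =
  off-cliques-zero p q pq ,
  end-weights-equal p q p q pq (side-class p q pq) ,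
  end-weights-equal p q q p (≢-sym pq) (λ v i → sideClass-swap (copy-id (3 +ℕ m)) (side-class p q pq v i))
  where
  open SideWeights F m f wc
  open SideClassification F f wc using (sideClass-swap)
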